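{- Let $\lambda$ be a partition, $\pi$ a reverse plane partition of shape $\lambda$, $h$ a rim-hook of $\lambda$ that inserts into $\pi$, and $P$ a south-west path in $\lambda$ such that $\omega(P)=\omega(h)$, $\ell(P)=\ell(h)$, $(P,\pi)$ is compatible and $\pi+P$ is a reverse plane partition. Then $P=P(h,\pi)$.
   Context: Cells are pairs $(i,j)\in\mathbb Z^2$; $\mathrm n(i,j)=(i-1,j)$, $\mathrm e(i,j)=(i,j+1)$, $\mathrm s(i,j)=(i+1,j)$, $\mathrm w(i,j)=(i,j-1)$. A partition $\lambda$ is identified with its Young diagram $\{(i,j):1\le i\le\ell(\lambda),1\le j\le\lambda_i\}$. A reverse plane partition of shape $\lambda$ is $\pi:\lambda\to\mathbb N$ with $\pi(u)\le\pi(\mathrm e u),\pi(\mathrm s u)$, with conventions $\pi(i,j)=0$ if $i\le0$ or $j\le0$, $\pi(i,j)=\infty$ if $i,j\ge1$, $(i,j)\notin\lambda$. Content $c(i,j)=j-i$; outer corner: $u\in\lambda$, $\mathrm e u,\mathrm s u\notin\lambda$; inner corner: $\mathrm e u,\mathrm s u\in\lambda$, $\mathrm e\mathrm s u\notin\lambda$. With inner corner contents $i_1<\dots<i_r$ and outer corner contents $o_1<\dots<o_{r+1}$ (interlacing), $\mathcal I=\{u\in\lambda:c(u)=i_k\}$, $\mathcal O=\{u\in\lambda:c(u)=o_k\}$, $\mathcal A=\{u\in\lambda:c(u)<o_1\text{ or }i_k<c(u)<o_{k+1}\text{ for some }k\in[r]\}$, $\mathcal B=\{u\in\lambda:o_k<c(u)<i_k\text{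 for some }k\in[r]\text{ or }c(u)>o_{r+1}\}$. North-east path: $(u_0,\dots,u_s)$ in $\lambda$, $u_k\in\{\mathrm n u_{k-1},\mathrm e u_{k-1}\}$, length $s$, head $\alpha=u_0$, tail $\omega=u_s$. South-west path: $(v_0,\dots,v_s)$ in $\lambda$, $v_k\in\{\mathrm s v_{k-1},\mathrm w v_{k-1}\}$, length $s$, $\alpha=v_s$, $\omega=v_0$. A rim-hook of $\lambda$ is a north-east path $h$ with $\mathrm s\alpha(h)\notin\lambda$, $\mathrm e\omega(h)\notin\lambda$, $\mathrm e\mathrm s u\notin\lambda$ for all $u\in h$. $(\pi+P)(u)=\pi(u)+1$ for $u\in P$, else $\pi(u)$. $(P,\pi)$ is compatible if: $u\in P\cap(\mathcal I\cup\mathcal A)$ implies $\mathrm e u\in P$ and $\pi(u)=\pi(\mathrm e u)$; and $u,\mathrm s u\in P$ implies $\pi(u)=\pi(\mathrm s u)$. $h$ inserts into $\pi$ if some path $P$ has $\omega(P)=\omega(h)$, $\ell(P)=\ell(h)$, $(P,\pi)$ compatible and $\pi+P$ a reverse plane partition. $P(h,\pi)$ is the south-west path starting at $\omega(h)$ which, while its length is less than $\ell(h)$, moves from the current cell $u$ to $\mathrm s u$ if $u\in\mathcal B\cup\mathcal I$ and $\pi(u)=\pi(\mathrm s u)$, and to $\mathrm w u$ otherwise. -}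

module Defs where

open import Data.Nat as ℕ using (ℕ; zero; suc)
open import Data.Integer as ℤ using (ℤ; +_; +[1+_]; -[1+_])
import Data.Integer.Properties as ℤP
open import Data.Product using (_×_; _,_; ∃-syntax; proj₁; proj₂)
open import Data.Product.Properties using (≡-dec)
open import Data.Sum using (_⊎_; inj₁; inj₂)
open import Data.Empty using (⊥)
open import Data.Bool using (if_then_else_)
open import Data.List using (List; []; _∷_; _++_; map; applyUpTo; filter; zip; drop; length)
open import Data.List.NonEmpty as List⁺ using (List⁺; _∷_; toList)
open import Data.List.Relation.Unary.All using (All)
open import Data.List.Relation.Unary.Any using (Any; any?)
open import Data.List.Relation.Unary.Linked using (Linked)
open import Data.List.Membership.Propositional using (_∈_)
open import Relation.Binary.PropositionalEquality using (_≡_)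
open import Relation.Binary.Definitions using (DecidableEquality)
open import Relation.Nullary using (¬_; Dec; yes; no; does)
open import Relation.Nullary.Decidable using (_×-dec_; _⊎-dec_; ¬?)
open import Data.List.Sort.InsertionSort.Base ℤP.≤-decTotalOrder using (sort)

Cell : Set
Cell = ℤ × ℤ

north east south west : Cell → Cell
north (i , j) = (ℤ.pred i , j)
east  (i , j) = (i , ℤ.suc j)
south (i , j) = (ℤ.suc i , j)
west  (i , j) = (i , ℤ.pred j)

content : Cell → ℤ
content (i , j) = j ℤ.- i

_≟C_ : DecidableEquality Cell
_≟C_ = ≡-dec ℤ._≟_ ℤ._≟_

IsPartition : List ℕ → Set
IsPartition la = Linked ℕ._≥_ la × All (λ p → 1 ℕ.≤ p) la

-- k-th part (0-indexed), 0 beyond the length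
part : List ℕ → ℕ → ℕ
part []       _       = 0
part (p ∷ _)  zero    = p
part (_ ∷ ps) (suc k) = part ps k

-- λ_i for a row index i ∈ ℤ (0 if i ≤ 0 or i > ℓ(λ))
rowLen : List ℕ → ℤ → ℕ
rowLen la +[1+ k ] = part la k
rowLen la _        = 0

_∈λ_ : Cell → List ℕ → Set
(i , j) ∈λ la = (+ 1 ℤ.≤ i) × (+ 1 ℤ.≤ j) × (j ℤ.≤ + rowLen la i)

_∈λ?_ : (u : Cell) (la : List ℕ) → Dec (u ∈λ la)
(i , j) ∈λ? la = (+ 1 ℤ.≤? i) ×-dec ((+ 1 ℤ.≤? j) ×-dec (j ℤ.≤? + rowLen la i))

cellsFrom : ℕ → List ℕ → List Cell
cellsFrom k []       = []
cellsFrom k (p ∷ ps) = map (λ j → (+[1+ k ] , + j)) (applyUpTo suc p) ++ cellsFrom (suc k) ps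

cells : List ℕ → List Cell
cells la = cellsFrom 0 la

OuterCorner : List ℕ → Cell → Set
OuterCorner la u = (u ∈λ la) × ¬ (east u ∈λ la) × ¬ (south u ∈λ la)

outer? : (la : List ℕ) (u : Cell) → Dec (OuterCorner la u)
outer? la u = (u ∈λ? la) ×-dec (¬? (east u ∈λ? la) ×-dec ¬? (south u ∈λ? la))

-- inner corner: e u ∈ λ, s u ∈ λ, e s u ∉ λ  (such u automatically lies in λ)
InnerCorner : List ℕ → Cell → Set
InnerCorner la u = (east u ∈λ la) × (south u ∈λ la) × ¬ (east (south u) ∈λ la)

inner? : (la : List ℕ) (u : Cell) → Dec (InnerCorner la u)
inner? la u = (east u ∈λ? la) ×-dec ((south u ∈λ? la) ×-dec ¬? (east (south u) ∈λ? la))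

-- o₁ < ... < o_{r+1}  and  i₁ < ... < i_r  as sorted lists of contents
outerContents : List ℕ → List ℤ
outerContents la = sort (map content (filter (outer? la) (cells la)))

innerContents : List ℕ → List ℤ
innerContents la = sort (map content (filter (inner? la) (cells la)))

belowFirst : ℤ → List ℤ → Set
belowFirst c []      = ⊥
belowFirst c (o ∷ _) = c ℤ.< o

aboveLast : ℤ → List ℤ → Set
aboveLast c []           = ⊥
aboveLast c (o ∷ [])     = o ℤ.< c
aboveLast c (_ ∷ o ∷ os) = aboveLast c (o ∷ os)

aboveLast? : (c : ℤ) (os : List ℤ) → Dec (aboveLast c os)
aboveLast? c []           = no (λ ())
aboveLast? c (o ∷ [])     = o ℤ.<? c
aboveLast? c (_ ∷ o ∷ os) = aboveLast? c (o ∷ os)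

Strictly : ℤ → ℤ × ℤ → Set
Strictly c (x , y) = (x ℤ.< c) × (c ℤ.< y)

strictly? : (c : ℤ) (p : ℤ × ℤ) → Dec (Strictly c p)
strictly? c (x , y) = (x ℤ.<? c) ×-dec (c ℤ.<? y)

_∈𝓘_ : Cell → List ℕ → Set
u ∈𝓘 la = (u ∈λ la) × Any (content u ≡_) (innerContents la)

_∈𝓞_ : Cell → List ℕ → Set
u ∈𝓞 la = (u ∈λ la) × Any (content u ≡_) (outerContents la)

-- 𝓐 = {u ∈ λ : c(u) < o₁ or i_k < c(u) < o_{k+1} for some k ∈ [r]}
_∈𝓐_ : Cell → List ℕ → Set
u ∈𝓐 la = (u ∈λ la) ×
  (belowFirst (content u) (outerContents la)
   ⊎ Any (Strictly (content u)) (zip (innerContents la) (drop 1 (outerContents la))))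

-- 𝓑 = {u ∈ λ : o_k < c(u) < i_k for some k ∈ [r], or c(u) > o_{r+1}}
_∈𝓑_ : Cell → List ℕ → Set
u ∈𝓑 la = (u ∈λ la) ×
  (Any (Strictly (content u)) (zip (outerContents la) (innerContents la))
   ⊎ aboveLast (content u) (outerContents la))

_∈𝓘?_ : (u : Cell) (la : List ℕ) → Dec (u ∈𝓘 la)
u ∈𝓘? la = (u ∈λ? la) ×-dec any? (λ x → content u ℤ.≟ x) (innerContents la)

_∈𝓑?_ : (u : Cell) (la : List ℕ) → Dec (u ∈𝓑 la)
u ∈𝓑? la = (u ∈λ? la) ×-dec
  (any? (strictly? (content u)) (zip (outerContents la) (innerContents la))
   ⊎-dec aboveLast? (content u) (outerContents la))

-- Reverse plane partitions
-- π is given as a function on all cells; only its values on λ matter.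
-- Conditions π(u) ≤ π(e u), π(u) ≤ π(s u) with e u / s u ∉ λ hold by the
-- convention π = ∞ there, so only the ones inside λ are required.

IsRPP : List ℕ → (Cell → ℕ) → Set
IsRPP la π = ∀ u → u ∈λ la →
  (east u ∈λ la → π u ℕ.≤ π (east u)) × (south u ∈λ la → π u ℕ.≤ π (south u))

NEStep : Cell → Cell → Set
NEStep u v = (v ≡ north u) ⊎ (v ≡ east u)

SWStep : Cell → Cell → Set
SWStep u v = (v ≡ south u) ⊎ (v ≡ west u)

IsNEPath : List ℕ → List⁺ Cell → Set
IsNEPath la p = Linked NEStep (toList p) × All (_∈λ la) (toList p)

IsSWPath : List ℕ → List⁺ Cell → Set
IsSWPath la p = Linked SWStep (toList p) × All (_∈λ la) (toList p)

len : List⁺ Cell → ℕ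
len p = length (List⁺.tail p)

αNE ωNE : List⁺ Cell → Cell
αNE p = List⁺.head p
ωNE p = List⁺.last p

-- head/tail of a south-west path: α = v_s, ω = v₀
αSW ωSW : List⁺ Cell → Cell
αSW p = List⁺.last p
ωSW p = List⁺.head p

IsRimHook : List ℕ → List⁺ Cell → Set
IsRimHook la h = IsNEPath la h × ¬ (south (αNE h) ∈λ la) × ¬ (east (ωNE h) ∈λ la)
  × All (λ u → ¬ (east (south u) ∈λ la)) (toList h)

_∈P_ : Cell → List⁺ Cell → Set
u ∈P P = u ∈ toList P

addPath : (Cell → ℕ) → List⁺ Cell → Cell → ℕ
addPath π P u = if does (Data.List.Membership.DecPropositional._∈?_ _≟C_ u (toList P))
  then suc (π u) else π u
  where import Data.List.Membership.DecPropositional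

Compatible : List ℕ → List⁺ Cell → (Cell → ℕ) → Set
Compatible la P π =
  (∀ u → u ∈P P → (u ∈𝓘 la ⊎ u ∈𝓐 la) → (east u ∈P P) × (π u ≡ π (east u)))
  × (∀ u → u ∈P P → south u ∈P P → π u ≡ π (south u))

Inserts : List ℕ → (Cell → ℕ) → List⁺ Cell → Set
Inserts la π h = ∃[ P ] IsSWPath la P × (ωSW P ≡ ωNE h) × (len P ≡ len h)
  × Compatible la P π × IsRPP la (addPath π P)

-- The path P(h, π)
-- Move south from u iff u ∈ 𝓑 ∪ 𝓘 and π(u) = π(s u); since u ∈ λ here,
-- s u ∉ λ means π(s u) = ∞ ≠ π(u), which is why s u ∈ λ is required.

MoveSouth : List ℕ → (Cell → ℕ) → Cell → Set
MoveSouth la π u = ((u ∈𝓑 la) ⊎ (u ∈𝓘 la)) × (south u ∈λ la) × (π u ≡ π (south u))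

moveSouth? : (la : List ℕ) (π : Cell → ℕ) (u : Cell) → Dec (MoveSouth la π u)
moveSouth? la π u = ((u ∈𝓑? la) ⊎-dec (u ∈𝓘? la)) ×-dec ((south u ∈λ? la) ×-dec (π u ℕ.≟ π (south u)))

nextCell : List ℕ → (Cell → ℕ) → Cell → Cell
nextCell la π u = if does (moveSouth? la π u) then south u else west u

walk : List ℕ → (Cell → ℕ) → ℕ → Cell → List Cell
walk la π zero    u = []
walk la π (suc k) u = nextCell la π u ∷ walk la π k (nextCell la π u)

P[_,_] : List ℕ → (Cell → ℕ) → List⁺ Cell → List⁺ Cell
P[ la , π ] h = ωNE h ∷ walk la π (len h) (ωNE h)

{-# OPTIONS --safe #-}
module Submission where

-- Contents strictly decrease along a south-west path, so P meets every content at most once, and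
-- this forces each step of P to be the one prescribed for P(h, π).  A west step from u although
-- s u ∈ λ and π(u) = π(s u) would leave s u (of the same content as w u) outside P, so π + P would
-- decrease from u to s u.  A south step gives π(u) = π(s u) by compatibility; and if u ∉ 𝓑 ∪ 𝓘,
-- then s u ∈ 𝓐 ∪ 𝓘 because the outer and inner corner contents interlace, so compatibility puts
-- e s u into P, a second cell of the content of u.

open import Defs
open import Data.Nat using (ℕ)
open import Data.List using (List)
open import Data.List.NonEmpty using (List⁺)
open import Relation.Binary.PropositionalEquality using (_≡_)

open import Data.Bool using (if_then_else_)
open import Data.Empty using (⊥-elim)
open import Data.Integer as ℤ using (ℤ; +_; +[1+_]; -[1+_]; 1ℤ; -1ℤ; +≤+; +<+)
import Data.Integer.Properties as ℤP
open import Data.Integer.Tactic.RingSolver using (solve-∀)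
open import Data.List using ([]; _∷_; _++_; [_]; map; filter; applyUpTo; zip; drop; length)
open import Data.List.Properties using (filter-none; filter-accept; filter-reject; filter-++; map-++; map-applyUpTo)
open import Data.List.Membership.Propositional using (_∈_)
open import Data.List.Membership.DecPropositional _≟C_ using (_∈?_)
open import Data.List.NonEmpty using (_∷_; toList)
open import Data.List.Relation.Unary.All as All using (All; []; _∷_)
import Data.List.Relation.Unary.All.Properties as AllP
open import Data.List.Relation.Unary.Any using (Any; here; there)
open import Data.List.Relation.Unary.Linked using (Linked; [-]; _∷_)
open import Data.List.Sort.InsertionSort.Base ℤP.≤-decTotalOrder using (sort; insert)
open import Data.Nat as ℕ using (zero; suc; z≤n; s≤s)
import Data.Nat.Properties as ℕP
open import Data.Product using (_×_; _,_; proj₁; proj₂)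
open import Data.Sum as Sum using (_⊎_; inj₁; inj₂; swap)
open import Function using (_∘_; id)
open import Level using (0ℓ)
open import Relation.Binary.Definitions using (tri<; tri≈; tri>)
open import Relation.Binary.PropositionalEquality using (_≢_; refl; sym; trans; cong; cong₂; subst; subst₂; module ≡-Reasoning)
open import Relation.Nullary using (¬_; yes; no)
open import Relation.Nullary.Decidable using (dec-true; dec-false; decidable-stable; _⊎-dec_)
open import Relation.Unary using (Pred; Decidable)

content-south : ∀ u → content (south u) ≡ ℤ.pred (content u)
content-south (i , j) = lemma i j
  where
  lemma : ∀ i j → j ℤ.- (1ℤ ℤ.+ i) ≡ -1ℤ ℤ.+ (j ℤ.- i)
  lemma = solve-∀

content-west : ∀ u → content (west u) ≡ ℤ.pred (content u)
content-west (i , j) = lemma i j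
  where
  lemma : ∀ i j → (-1ℤ ℤ.+ j) ℤ.- i ≡ -1ℤ ℤ.+ (j ℤ.- i)
  lemma = solve-∀

content-east-south : ∀ u → content (east (south u)) ≡ content u
content-east-south (i , j) = lemma i j
  where
  lemma : ∀ i j → (1ℤ ℤ.+ j) ℤ.- (1ℤ ℤ.+ i) ≡ j ℤ.- i
  lemma = solve-∀

south≢west : ∀ u → south u ≢ west u
south≢west u eq = ℤP.i≢suc[i] (sym (cong proj₁ eq))

east-south≢id : ∀ u → east (south u) ≢ u
east-south≢id u eq = ℤP.i≢suc[i] (sym (cong proj₁ eq))

pred[c]<c : ∀ c → ℤ.pred c ℤ.< c
pred[c]<c c = ℤP.i≤pred[j]⇒i<j ℤP.≤-refl

SWStep⇒content< : ∀ {u v} → SWStep u v → content v ℤ.< content u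
SWStep⇒content< {u} (inj₁ refl) = subst (ℤ._< content u) (sym (content-south u)) (pred[c]<c _)
SWStep⇒content< {u} (inj₂ refl) = subst (ℤ._< content u) (sym (content-west u)) (pred[c]<c _)

SWPath-content< : ∀ {z zs} → Linked SWStep (z ∷ zs) → All (λ w → content w ℤ.< content z) zs
SWPath-content< [-]          = []
SWPath-content< (step ∷ path) =
  SWStep⇒content< step ∷ All.map (λ lt → ℤP.<-trans lt (SWStep⇒content< step)) (SWPath-content< path)

SWPath-content-injective : ∀ {xs w v} → Linked SWStep xs → w ∈ xs → v ∈ xs → content w ≡ content v → w ≡ v
SWPath-content-injective path      (here refl) (here refl) _  = refl
SWPath-content-injective path      (here refl) (there v∈) eq = ⊥-elim (ℤP.<-irrefl (sym eq) (All.lookup (SWPath-content< path) v∈))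
SWPath-content-injective path      (there w∈) (here refl) eq = ⊥-elim (ℤP.<-irrefl eq (All.lookup (SWPath-content< path) w∈))
SWPath-content-injective (_ ∷ path) (there w∈) (there v∈) eq = SWPath-content-injective path w∈ v∈ eq

addPath-∈ : ∀ π P {u} → u ∈P P → addPath π P u ≡ suc (π u)
addPath-∈ π P {u} u∈ = cong (λ b → if b then suc (π u) else π u) (dec-true (u ∈? toList P) u∈)

addPath-∉ : ∀ π P {u} → ¬ u ∈P P → addPath π P u ≡ π u
addPath-∉ π P {u} u∉ = cong (λ b → if b then suc (π u) else π u) (dec-false (u ∈? toList P) u∉)

nextCell-south : ∀ la π {u} → MoveSouth la π u → nextCell la π u ≡ south u
nextCell-south la π {u} move = cong (λ b → if b then south u else west u) (dec-true (moveSouth? la π u) move)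

nextCell-west : ∀ la π {u} → ¬ MoveSouth la π u → nextCell la π u ≡ west u
nextCell-west la π {u} ¬move = cong (λ b → if b then south u else west u) (dec-false (moveSouth? la π u) ¬move)

𝓐-content 𝓑-content : List ℤ → List ℤ → ℤ → Set
𝓐-content O I c = belowFirst c O ⊎ Any (Strictly c) (zip I (drop 1 O))
𝓑-content O I c = Any (Strictly c) (zip O I) ⊎ aboveLast c O

𝓘-content : List ℤ → ℤ → Set
𝓘-content I c = Any (c ≡_) I

data Interlace : List ℤ → List ℤ → Set where
  end  : ∀ o → Interlace (o ∷ []) []
  next : ∀ {o i o' os is} → o ℤ.< i → i ℤ.< o' → Interlace (o' ∷ os) is → Interlace (o ∷ o' ∷ os) (i ∷ is)

pred-𝓐⊎𝓘 : ∀ {O I} → Interlace O I → ∀ c → ¬ 𝓑-content O I c → ¬ 𝓘-content I c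
          → 𝓐-content O I (ℤ.pred c) ⊎ 𝓘-content I (ℤ.pred c)
pred-𝓐⊎𝓘 (end o) c ¬B ¬I with c ℤ.≤? o
... | yes c≤o = inj₁ (inj₁ (ℤP.<-≤-trans (pred[c]<c c) c≤o))
... | no  c≰o = ⊥-elim (¬B (inj₂ (ℤP.≰⇒> c≰o)))
pred-𝓐⊎𝓘 (next {o} {i} {o'} {os} {is} _ _ rest) c ¬B ¬I with c ℤ.≤? o | ℤP.<-cmp c i
... | yes c≤o | _            = inj₁ (inj₁ (ℤP.<-≤-trans (pred[c]<c c) c≤o))
... | no  c≰o | tri< c<i _ _ = ⊥-elim (¬B (inj₁ (here (ℤP.≰⇒> c≰o , c<i))))
... | no  _   | tri≈ _ c≡i _ = ⊥-elim (¬I (here c≡i))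
... | no  _   | tri> _ _ i<c = extend (pred-𝓐⊎𝓘 rest c (¬B ∘ Sum.map₁ there) (¬I ∘ there))
  where
  extend : 𝓐-content (o' ∷ os) is (ℤ.pred c) ⊎ 𝓘-content is (ℤ.pred c)
         → 𝓐-content (o ∷ o' ∷ os) (i ∷ is) (ℤ.pred c) ⊎ 𝓘-content (i ∷ is) (ℤ.pred c)
  extend (inj₂ d∈I)          = inj₂ (there d∈I)
  extend (inj₁ (inj₂ d∈A))   = inj₁ (inj₂ (there d∈A))
  extend (inj₁ (inj₁ d<o')) with i ℤ.≟ ℤ.pred c
  ... | yes i≡d = inj₂ (here (sym i≡d))
  ... | no  i≢d = inj₁ (inj₂ (here (ℤP.≤∧≢⇒< (ℤP.i<j⇒i≤pred[j] i<c) i≢d , d<o')))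

Interlace-∷ʳ : ∀ {O I i o'} → Interlace O I → All (ℤ._< i) O → i ℤ.< o' → Interlace (O ++ [ o' ]) (I ++ [ i ])
Interlace-∷ʳ (end o)           (o<i ∷ []) i<o' = next o<i i<o' (end _)
Interlace-∷ʳ (next o<i i<o' I) (_ ∷ O<i)  i<o'' = next o<i i<o' (Interlace-∷ʳ I O<i i<o'')

insert-max : ∀ x ys → All (ℤ._< x) ys → insert x ys ≡ ys ++ [ x ]
insert-max x []       []          = refl
insert-max x (y ∷ ys) (y<x ∷ ys<x) =
  trans (cong (λ b → if b then x ∷ y ∷ ys else y ∷ insert x ys) (dec-false (x ℤ.≤? y) (ℤP.<⇒≱ y<x)))
        (cong (y ∷_) (insert-max x ys ys<x))

module _ {A : Set} {P : Pred A 0ℓ} (P? : Decidable P) where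

  filter-applyUpTo-none : ∀ f n → (∀ {j} → j ℕ.< n → ¬ P (f j)) → filter P? (applyUpTo f n) ≡ []
  filter-applyUpTo-none f n ¬P = filter-none P? (AllP.applyUpTo⁺₁ f n ¬P)

  filter-applyUpTo-single : ∀ f {n t} → t ℕ.< n → P (f t) → (∀ {j} → j ℕ.< n → P (f j) → j ≡ t)
                          → filter P? (applyUpTo f n) ≡ [ f t ]
  filter-applyUpTo-single f {suc n} {zero} _ Pf0 only-t =
    trans (filter-accept P? Pf0)
          (cong (f 0 ∷_) (filter-applyUpTo-none (f ∘ suc) n (λ j<n Pf → ℕP.1+n≢0 (only-t (s≤s j<n) Pf))))
  filter-applyUpTo-single f {suc n} {suc t} (s≤s t<n) Pft only-t =
    trans (filter-reject P? (λ Pf0 → ℕP.0≢1+n (only-t (s≤s z≤n) Pf0)))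
          (filter-applyUpTo-single (f ∘ suc) t<n Pft (λ j<n Pf → ℕP.suc-injective (only-t (s≤s j<n) Pf)))

∉λ-[] : ∀ u → ¬ (u ∈λ [])
∉λ-[] (+[1+ _ ] , _) (_ , 1≤j , j≤0) with ℤP.≤-trans 1≤j j≤0
... | +≤+ ()
∉λ-[] (+ zero , _)    (+≤+ () , _)
∉λ-[] (-[1+ _ ] , _)  (() , _)

module Corners (la : List ℕ) where

  -- Row k + 1 of la has length part la k.
  cell : ℕ → ℕ → Cell
  cell k j = (+[1+ k ] , + j)

  rowContents : {C : Pred Cell 0ℓ} → Decidable C → ℕ → ℕ → List ℤ
  rowContents C? k p = map content (filter C? (applyUpTo (cell k ∘ suc) p))

  module Row {k p q : ℕ} (part-k : part la k ≡ p) (part-k+1 : part la (suc k) ≡ q) where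

    ∈λ-row : ∀ {j} → 1 ℕ.≤ j → j ℕ.≤ p → cell k j ∈λ la
    ∈λ-row 1≤j j≤p = +≤+ (s≤s z≤n) , +≤+ 1≤j , +≤+ (subst (_ ℕ.≤_) (sym part-k) j≤p)

    ∈λ-row⁻ : ∀ {j} → cell k j ∈λ la → j ℕ.≤ p
    ∈λ-row⁻ (_ , _ , +≤+ j≤p) = subst (_ ℕ.≤_) part-k j≤p

    ∈λ-nextRow : ∀ {j} → 1 ℕ.≤ j → j ℕ.≤ q → cell (suc k) j ∈λ la
    ∈λ-nextRow 1≤j j≤q = +≤+ (s≤s z≤n) , +≤+ 1≤j , +≤+ (subst (_ ℕ.≤_) (sym part-k+1) j≤q)

    ∈λ-nextRow⁻ : ∀ {j} → cell (suc k) j ∈λ la → j ℕ.≤ q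
    ∈λ-nextRow⁻ (_ , _ , +≤+ j≤q) = subst (_ ℕ.≤_) part-k+1 j≤q

    outerCorner⁻ : ∀ {j} → OuterCorner la (cell k j) → j ≡ p × q ℕ.< p
    outerCorner⁻ {j} (u∈@(_ , +≤+ 1≤j , _) , e∉ , s∉) = j≡p , q<p
      where
      j≡p : j ≡ p
      j≡p = ℕP.≤-antisym (∈λ-row⁻ u∈) (ℕP.≮⇒≥ (λ j<p → e∉ (∈λ-row (s≤s z≤n) j<p)))
      q<p : q ℕ.< p
      q<p = ℕP.≰⇒> (λ p≤q → s∉ (∈λ-nextRow 1≤j (subst (ℕ._≤ q) (sym j≡p) p≤q)))

    outerCorner : 1 ℕ.≤ p → q ℕ.< p → OuterCorner la (cell k p)
    outerCorner 1≤p q<p =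
      ∈λ-row 1≤p ℕP.≤-refl , (λ e∈ → ℕP.n≮n p (∈λ-row⁻ e∈)) , (λ s∈ → ℕP.<⇒≱ q<p (∈λ-nextRow⁻ s∈))

    innerCorner⁻ : ∀ {j} → InnerCorner la (cell k j) → j ≡ q × q ℕ.< p
    innerCorner⁻ {j} (e∈ , s∈ , es∉) = j≡q , subst (ℕ._< p) j≡q (∈λ-row⁻ e∈)
      where
      j≡q : j ≡ q
      j≡q = ℕP.≤-antisym (∈λ-nextRow⁻ s∈) (ℕP.≮⇒≥ (λ j<q → es∉ (∈λ-nextRow (s≤s z≤n) j<q)))

    innerCorner : 1 ℕ.≤ q → q ℕ.< p → InnerCorner la (cell k q)
    innerCorner 1≤q q<p =
      ∈λ-row (s≤s z≤n) q<p , ∈λ-nextRow 1≤q ℕP.≤-refl , (λ es∈ → ℕP.n≮n q (∈λ-nextRow⁻ es∈))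

    outerRow-none : ¬ q ℕ.< p → rowContents (outer? la) k p ≡ []
    outerRow-none ¬q<p = cong (map content) (filter-applyUpTo-none (outer? la) (cell k ∘ suc) p (λ _ oc → ¬q<p (proj₂ (outerCorner⁻ oc))))

    outerRow-corner : q ℕ.< p → rowContents (outer? la) k p ≡ [ content (cell k p) ]
    outerRow-corner q<p@(s≤s _) = cong (map content) (filter-applyUpTo-single (outer? la) (cell k ∘ suc) ℕP.≤-refl
      (outerCorner (ℕP.≤-trans (s≤s z≤n) q<p) q<p) (λ _ oc → ℕP.suc-injective (proj₁ (outerCorner⁻ oc))))

    innerRow-none : ¬ (1 ℕ.≤ q × q ℕ.< p) → rowContents (inner? la) k p ≡ []
    innerRow-none ¬corner = cong (map content) (filter-applyUpTo-none (inner? la) (cell k ∘ suc) p (λ _ ic →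
      let j+1≡q , q<p = innerCorner⁻ ic in ¬corner (subst (1 ℕ.≤_) j+1≡q (s≤s z≤n) , q<p)))

    innerRow-corner : 1 ℕ.≤ q → q ℕ.< p → rowContents (inner? la) k p ≡ [ content (cell k q) ]
    innerRow-corner 1≤q@(s≤s _) q<p = cong (map content) (filter-applyUpTo-single (inner? la) (cell k ∘ suc) (ℕP.<⇒≤ q<p)
      (innerCorner 1≤q q<p) (λ _ ic → ℕP.suc-injective (proj₁ (innerCorner⁻ ic))))

  contentsFrom : {C : Pred Cell 0ℓ} → Decidable C → ℕ → List ℕ → List ℤ
  contentsFrom C? k ps = map content (filter C? (cellsFrom k ps))

  contentsFrom-∷ : ∀ {C : Pred Cell 0ℓ} (C? : Decidable C) k p ps
                 → contentsFrom C? k (p ∷ ps) ≡ rowContents C? k p ++ contentsFrom C? (suc k) ps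
  contentsFrom-∷ C? k p ps = begin
    map content (filter C? (map (cell k) (applyUpTo suc p) ++ rest))
      ≡⟨ cong (λ row → map content (filter C? (row ++ rest))) (map-applyUpTo suc (cell k) p) ⟩
    map content (filter C? (applyUpTo (cell k ∘ suc) p ++ rest))
      ≡⟨ cong (map content) (filter-++ C? (applyUpTo (cell k ∘ suc) p) rest) ⟩
    map content (filter C? (applyUpTo (cell k ∘ suc) p) ++ filter C? rest)
      ≡⟨ map-++ content (filter C? (applyUpTo (cell k ∘ suc) p)) (filter C? rest) ⟩
    rowContents C? k p ++ contentsFrom C? (suc k) ps ∎
    where
    open ≡-Reasoning
    rest = cellsFrom (suc k) ps

  content-mono : ∀ k {j j'} → j ℕ.≤ j' → content (cell k j) ℤ.≤ content (cell k j')
  content-mono k j≤j' = ℤP.+-monoˡ-≤ (ℤ.- +[1+ k ]) (+≤+ j≤j')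

  content-strictMono : ∀ k {j j'} → j ℕ.< j' → content (cell k j) ℤ.< content (cell k j')
  content-strictMono k j<j' = ℤP.+-monoˡ-< (ℤ.- +[1+ k ]) (+<+ j<j')

  content-nextRow< : ∀ k j → content (cell (suc k) j) ℤ.< content (cell k j)
  content-nextRow< k j = subst (ℤ._< content (cell k j)) (sym (content-south (cell k j))) (pred[c]<c (content (cell k j)))

  content-nextRow≤ : ∀ k {j j'} → j ℕ.≤ j' → content (cell (suc k) j) ℤ.≤ content (cell k j')
  content-nextRow≤ k {j} j≤j' = ℤP.≤-trans (ℤP.<⇒≤ (content-nextRow< k j)) (content-mono k j≤j')

  Suffix : ℕ → List ℕ → Set
  Suffix k ps = ∀ m → part la (m ℕ.+ k) ≡ part ps m

  Suffix-tail : ∀ {k p ps} → Suffix k (p ∷ ps) → Suffix (suc k) ps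
  Suffix-tail {k} suffix m = trans (cong (part la) (ℕP.+-suc m k)) (suffix (suc m))

  -- Going up one row, from part la (suc k) = q to part la k = p, adds the outer corner content
  -- c(k + 1, p) iff q < p and the inner corner content c(k + 1, q) iff 0 < q < p; both exceed every
  -- content of the rows below, so insertion sort appends them.
  BoundedInterlace : ℤ → List ℤ → List ℤ → Set
  BoundedInterlace b O I = Interlace (sort O) (sort I) × All (ℤ._≤ b) (sort O) × All (ℤ._≤ b) (sort I)

  outerFrom innerFrom : ℕ → List ℕ → List ℤ
  outerFrom = contentsFrom (outer? la)
  innerFrom = contentsFrom (inner? la)

  ≤-weaken : ∀ {a b} {xs : List ℤ} → a ℤ.≤ b → All (ℤ._≤ a) xs → All (ℤ._≤ b) xs
  ≤-weaken a≤b = All.map (λ x≤a → ℤP.≤-trans x≤a a≤b)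

  flatRow : ∀ {k p p' ps} → Suffix k (p ∷ p' ∷ ps) → p' ≡ p
          → BoundedInterlace (content (cell (suc k) p')) (outerFrom (suc k) (p' ∷ ps)) (innerFrom (suc k) (p' ∷ ps))
          → BoundedInterlace (content (cell k p)) (outerFrom k (p ∷ p' ∷ ps)) (innerFrom k (p ∷ p' ∷ ps))
  flatRow {k} {p} {p'} {ps} suffix p'≡p (interlace , O≤ , I≤) =
    subst₂ (BoundedInterlace (content (cell k p))) (sym outer≡) (sym inner≡) (interlace , ≤-weaken bound O≤ , ≤-weaken bound I≤)
    where
    open Row (suffix 0) (suffix 1)
    bound = content-nextRow≤ k (ℕP.≤-reflexive p'≡p)
    outer≡ : outerFrom k (p ∷ p' ∷ ps) ≡ outerFrom (suc k) (p' ∷ ps)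
    outer≡ = trans (contentsFrom-∷ (outer? la) k p (p' ∷ ps))
                   (cong (_++ _) (outerRow-none (ℕP.<-irrefl p'≡p)))
    inner≡ : innerFrom k (p ∷ p' ∷ ps) ≡ innerFrom (suc k) (p' ∷ ps)
    inner≡ = trans (contentsFrom-∷ (inner? la) k p (p' ∷ ps))
                   (cong (_++ _) (innerRow-none (ℕP.<-irrefl p'≡p ∘ proj₂)))

  cornerRow : ∀ {k p p' ps} → Suffix k (p ∷ p' ∷ ps) → 1 ℕ.≤ p' → p' ℕ.< p
            → BoundedInterlace (content (cell (suc k) p')) (outerFrom (suc k) (p' ∷ ps)) (innerFrom (suc k) (p' ∷ ps))
            → BoundedInterlace (content (cell k p)) (outerFrom k (p ∷ p' ∷ ps)) (innerFrom k (p ∷ p' ∷ ps))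
  cornerRow {k} {p} {p'} {ps} suffix 1≤p' p'<p (interlace , O≤ , I≤) =
    subst₂ (BoundedInterlace (content (cell k p))) (sym outer≡) (sym inner≡)
      ( subst₂ Interlace (sym (insert-max _ _ O<p)) (sym (insert-max _ _ I<p'))
               (Interlace-∷ʳ interlace O<p' (content-strictMono k p'<p))
      , subst (All (ℤ._≤ _)) (sym (insert-max _ _ O<p)) (AllP.++⁺ (≤-weaken bound O≤) (ℤP.≤-refl ∷ []))
      , subst (All (ℤ._≤ _)) (sym (insert-max _ _ I<p')) (AllP.++⁺ (≤-weaken bound I≤) (content-mono k (ℕP.<⇒≤ p'<p) ∷ [])))
    where
    open Row (suffix 0) (suffix 1)
    bound = content-nextRow≤ k (ℕP.<⇒≤ p'<p)
    O<p' : All (ℤ._< content (cell k p')) (sort (outerFrom (suc k) (p' ∷ ps)))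
    O<p' = All.map (λ x≤ → ℤP.≤-<-trans x≤ (content-nextRow< k p')) O≤
    O<p : All (ℤ._< content (cell k p)) (sort (outerFrom (suc k) (p' ∷ ps)))
    O<p = All.map (λ x< → ℤP.<-trans x< (content-strictMono k p'<p)) O<p'
    I<p' : All (ℤ._< content (cell k p')) (sort (innerFrom (suc k) (p' ∷ ps)))
    I<p' = All.map (λ x≤ → ℤP.≤-<-trans x≤ (content-nextRow< k p')) I≤
    outer≡ : outerFrom k (p ∷ p' ∷ ps) ≡ content (cell k p) ∷ outerFrom (suc k) (p' ∷ ps)
    outer≡ = trans (contentsFrom-∷ (outer? la) k p (p' ∷ ps)) (cong (_++ _) (outerRow-corner p'<p))
    inner≡ : innerFrom k (p ∷ p' ∷ ps) ≡ content (cell k p') ∷ innerFrom (suc k) (p' ∷ ps)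
    inner≡ = trans (contentsFrom-∷ (inner? la) k p (p' ∷ ps)) (cong (_++ _) (innerRow-corner 1≤p' p'<p))

  cornerContents-interlace : ∀ k p ps → Suffix k (p ∷ ps) → Linked ℕ._≥_ (p ∷ ps) → All (1 ℕ.≤_) (p ∷ ps)
                           → BoundedInterlace (content (cell k p)) (outerFrom k (p ∷ ps)) (innerFrom k (p ∷ ps))
  cornerContents-interlace k p [] suffix _ (1≤p ∷ []) =
    subst₂ (BoundedInterlace _) (sym outer≡) (sym inner≡) (end _ , ℤP.≤-refl ∷ [] , [])
    where
    open Row (suffix 0) (suffix 1)
    outer≡ : outerFrom k (p ∷ []) ≡ [ content (cell k p) ]
    outer≡ = trans (contentsFrom-∷ (outer? la) k p []) (cong (_++ []) (outerRow-corner 1≤p))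
    inner≡ : innerFrom k (p ∷ []) ≡ []
    inner≡ = trans (contentsFrom-∷ (inner? la) k p []) (cong (_++ []) (innerRow-none λ { (() , _) }))
  cornerContents-interlace k p (p' ∷ ps) suffix (p'≤p ∷ decreasing) (_ ∷ positive@(1≤p' ∷ _))
    with cornerContents-interlace (suc k) p' ps (Suffix-tail suffix) decreasing positive | p' ℕ.≟ p
  ... | below | yes p'≡p = flatRow suffix p'≡p below
  ... | below | no  p'≢p = cornerRow suffix 1≤p' (ℕP.≤∧≢⇒< p'≤p p'≢p) below

outer-inner-interlace : ∀ {la} → IsPartition la → ∀ {u} → u ∈λ la → Interlace (outerContents la) (innerContents la)
outer-inner-interlace {[]}     _                        {u} u∈ = ⊥-elim (∉λ-[] u u∈)
outer-inner-interlace {p ∷ ps} (decreasing , positive) _      =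
  proj₁ (cornerContents-interlace 0 p ps (λ m → cong (part (p ∷ ps)) (ℕP.+-identityʳ m)) decreasing positive)
  where open Corners (p ∷ ps)

south-∈𝓐⊎𝓘 : ∀ {la} → IsPartition la → ∀ {x} → x ∈λ la → south x ∈λ la → ¬ x ∈𝓑 la → ¬ x ∈𝓘 la
            → south x ∈𝓐 la ⊎ south x ∈𝓘 la
south-∈𝓐⊎𝓘 {la} partition {x} x∈ sx∈ x∉𝓑 x∉𝓘 =
  Sum.map (sx∈ ,_) (sx∈ ,_)
    (subst (λ d → 𝓐-content O I d ⊎ 𝓘-content I d) (sym (content-south x))
           (pred-𝓐⊎𝓘 (outer-inner-interlace partition x∈) (content x) (x∉𝓑 ∘ (x∈ ,_)) (x∉𝓘 ∘ (x∈ ,_))))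
  where
  O = outerContents la
  I = innerContents la

module ForcedPath (la : List ℕ) (partition : IsPartition la) (π : Cell → ℕ) (P : List⁺ Cell)
                  (P-path : IsSWPath la P) (compatible : Compatible la P π) (π+P-rpp : IsRPP la (addPath π P))
                  where

  P⊆λ : All (_∈λ la) (toList P)
  P⊆λ = proj₂ P-path

  same-content⇒≡ : ∀ {w v} → w ∈P P → v ∈P P → content w ≡ content v → w ≡ v
  same-content⇒≡ = SWPath-content-injective (proj₁ P-path)

  south-step⇒moveSouth : ∀ {x} → x ∈P P → south x ∈P P → MoveSouth la π x
  south-step⇒moveSouth {x} x∈ sx∈ = x∈𝓑⊎𝓘 , sx∈λ , proj₂ compatible x x∈ sx∈
    where
    x∈λ = All.lookup P⊆λ x∈
    sx∈λ = All.lookup P⊆λ sx∈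
    x∈𝓑⊎𝓘 : x ∈𝓑 la ⊎ x ∈𝓘 la
    x∈𝓑⊎𝓘 = decidable-stable ((x ∈𝓑? la) ⊎-dec (x ∈𝓘? la)) λ x∉𝓑∪𝓘 →
      let sx∈𝓐∪𝓘 = south-∈𝓐⊎𝓘 partition x∈λ sx∈λ (x∉𝓑∪𝓘 ∘ inj₁) (x∉𝓑∪𝓘 ∘ inj₂)
          esx∈ = proj₁ (proj₁ compatible (south x) sx∈ (swap sx∈𝓐∪𝓘))
      in east-south≢id x (same-content⇒≡ esx∈ x∈ (content-east-south x))

  west-step⇒¬moveSouth : ∀ {x} → x ∈P P → west x ∈P P → ¬ MoveSouth la π x
  west-step⇒¬moveSouth {x} x∈ wx∈ (_ , sx∈λ , πx≡πsx) = ℕP.n≮n (π x) π[x]<π[x]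
    where
    sx∉ : ¬ south x ∈P P
    sx∉ sx∈ = south≢west x (same-content⇒≡ sx∈ wx∈ (trans (content-south x) (sym (content-west x))))
    π[x]<π[x] : π x ℕ.< π x
    π[x]<π[x] = subst₂ ℕ._≤_ (addPath-∈ π P x∈) (trans (addPath-∉ π P sx∉) (sym πx≡πsx))
                         (proj₂ (π+P-rpp x (All.lookup P⊆λ x∈)) sx∈λ)

  step-forced : ∀ {x y} → x ∈P P → y ∈P P → SWStep x y → y ≡ nextCell la π x
  step-forced x∈ y∈ (inj₁ refl) = sym (nextCell-south la π (south-step⇒moveSouth x∈ y∈))
  step-forced x∈ y∈ (inj₂ refl) = sym (nextCell-west la π (west-step⇒¬moveSouth x∈ y∈))

  walk-forced : ∀ x xs → Linked SWStep (x ∷ xs) → All (_∈P P) (x ∷ xs) → xs ≡ walk la π (length xs) x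
  walk-forced x []       _              _            = refl
  walk-forced x (y ∷ ys) (step ∷ steps) (x∈ ∷ y∈ys) =
    cong₂ _∷_ y≡next (trans (walk-forced y ys steps y∈ys) (cong (walk la π (length ys)) y≡next))
    where
    y≡next : y ≡ nextCell la π x
    y≡next = step-forced x∈ (All.head y∈ys) step

mainTheorem4 : (la : List ℕ) → IsPartition la
    → (π : Cell → ℕ) → IsRPP la π
    → (h : List⁺ Cell) → IsRimHook la h → Inserts la π h
    → (P : List⁺ Cell) → IsSWPath la P
    → ωSW P ≡ ωNE h → len P ≡ len h
    → Compatible la P π → IsRPP la (addPath π P)
    → P ≡ P[ la , π ] h
mainTheorem4 la partition π _ h _ _ P@(x ∷ xs) P-path ω≡ len≡ compatible π+P-rpp = begin
  x ∷ xs                              ≡⟨ cong (x ∷_) (walk-forced x xs (proj₁ P-path) (All.tabulate id)) ⟩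
  x ∷ walk la π (length xs) x         ≡⟨ cong₂ (λ u n → u ∷ walk la π n u) ω≡ len≡ ⟩
  ωNE h ∷ walk la π (len h) (ωNE h)   ∎
  where
  open ≡-Reasoning
  open ForcedPath la partition π P P-path compatible π+P-rpp
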